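{- Let $(G,\lambda)$ be a temporally connected temporal graph with $G=(V,E)$ and $|\lambda|=m$. Consider the gossip setting in which each vertex of $V$ is an agent initially knowing only its own secret, and a phone call between two agents adjacent in $G$ makes both of them learn all secrets currently known to either. Then there exists a sequence $c(1),c(2),\dots,c(m)$ of $m$ phone calls, each between the two endpoints of an edge of $G$, after which every agent knows the secret of every other agent.
   Context: A temporal graph is a pair $(G,\lambda)$ where $G=(V,E)$ is an undirected graph and $\lambda: E\to 2^{\mathbb{N}}$ assigns to each edge a set of positive integer time-labels; $|\lambda|=\sum_{e\in E}|\lambda(e)|$. A (strict) temporal path is a sequence $(e_1,t_1),\dots,(e_k,t_k)$ where $(e_1,\dots,e_k)$ is a path in $G$, $t_i\in\lambda(e_i)$, and $t_1<\dots<t_k$. $(G,\lambda)$ is temporally connected if for every ordered pair of distinct vertices $u,v$ there is a temporal path from $u$ to $v$. Calls happen one at a time, in the given order. -}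

module Defs where

open import Data.Nat using (ℕ; zero; suc; _<_)
open import Data.Fin using (Fin; _≟_)
open import Data.Fin.Subset using (Subset; _∪_; ⁅_⁆; _∈_)
open import Data.Product using (Σ; ∃; _×_; _,_; proj₁; proj₂; swap)
open import Data.Sum using (_⊎_)
open import Data.List using (List; []; _∷_; length; map; foldl)
open import Data.Nat.ListAction using (sum)
open import Data.List.Relation.Unary.All using (All)
open import Data.List.Relation.Unary.AllPairs using (AllPairs)
import Data.List.Relation.Unary.Unique.Propositional as UniqueP
import Data.List.Membership.Propositional as ListMem
open import Relation.Binary.PropositionalEquality using (_≡_; _≢_)
open import Relation.Nullary using (¬_; yes; no)

-- An (undirected) edge {u,v} is stored as an ordered
-- pair (u , v); a labelled edge is an edge together with its label set λ(e),
-- given as a duplicate-free list of positive naturals.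
Edge : ℕ → Set
Edge n = Fin n × Fin n

LEdge : ℕ → Set
LEdge n = Edge n × List ℕ

SameEdge : ∀ {n} → Edge n → Edge n → Set
SameEdge e f = (e ≡ f) ⊎ (swap e ≡ f)

record TemporalGraph (n : ℕ) : Set where
  field
    ledges    : List (LEdge n)
    loopless  : All (λ le → proj₁ (proj₁ le) ≢ proj₂ (proj₁ le)) ledges
    simple    : AllPairs (λ le le′ → ¬ SameEdge (proj₁ le) (proj₁ le′)) ledges
    labelsSet : All (λ le → UniqueP.Unique (proj₂ le)) ledges
    labelsPos : All (λ le → All (λ t → 0 < t) (proj₂ le)) ledges

open TemporalGraph public

size : ∀ {n} → TemporalGraph n → ℕ
size G = sum (map (λ le → length (proj₂ le)) (ledges G))

EdgeWithLabels : ∀ {n} → TemporalGraph n → Fin n → Fin n → List ℕ → Set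
EdgeWithLabels G a b ls =
  ListMem._∈_ ((a , b) , ls) (ledges G) ⊎ ListMem._∈_ ((b , a) , ls) (ledges G)

IsEdge : ∀ {n} → TemporalGraph n → Fin n → Fin n → Set
IsEdge G a b = ∃ λ ls → EdgeWithLabels G a b ls

HasEdgeAt : ∀ {n} → TemporalGraph n → Fin n → Fin n → ℕ → Set
HasEdgeAt G a b t = ∃ λ ls → EdgeWithLabels G a b ls × ListMem._∈_ t ls

-- TWalk G a t v vs : a sequence of time-edges from a to v, all of whose
-- times are strictly increasing and strictly larger than t; vs lists the
-- vertices visited after a.
data TWalk {n} (G : TemporalGraph n) : Fin n → ℕ → Fin n → List (Fin n) → Set where
  stop : ∀ {a t} → TWalk G a t a []
  step : ∀ {a b t t′ v vs} → HasEdgeAt G a b t′ → t < t′ →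
         TWalk G b t′ v vs → TWalk G a t v (b ∷ vs)

-- strict temporal path from u to v: the underlying walk is a path
-- (pairwise distinct vertices); labels are positive, so bound 0 is no restriction
TemporalPath : ∀ {n} → TemporalGraph n → Fin n → Fin n → Set
TemporalPath G u v = ∃ λ vs → TWalk G u 0 v vs × UniqueP.Unique (u ∷ vs)

TemporallyConnected : ∀ {n} → TemporalGraph n → Set
TemporallyConnected {n} G = (u v : Fin n) → u ≢ v → TemporalPath G u v

Knowledge : ℕ → Set
Knowledge n = Fin n → Subset n

initial : ∀ {n} → Knowledge n
initial i = ⁅ i ⁆

call : ∀ {n} → Knowledge n → Fin n × Fin n → Knowledge n
call K (a , b) x with x ≟ a | x ≟ b
... | yes _ | _     = K a ∪ K b
... | no _  | yes _ = K a ∪ K b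
... | no _  | no _  = K x

runCalls : ∀ {n} → List (Fin n × Fin n) → Knowledge n
runCalls cs = foldl call initial cs

AllKnowAll : ∀ {n} → Knowledge n → Set
AllKnowAll {n} K = (x y : Fin n) → y ∈ K x

-- Schedule one call per time-edge (e , t), ordered by t.  The edges of a strict
-- temporal path from y to x then occur in this schedule in path order, i.e. as a
-- sublist, and a secret is relayed along any chain of calls that appears as a
-- sublist of the schedule.
module Submission where

open import Defs
open import Data.Nat using (ℕ; _≤_; _<_; _+_)
open import Data.Nat.Properties
  using (≤-trans; <-trans; <-irrefl; ≤-<-trans; ≤-decTotalOrder)
open import Data.Nat.ListAction using (sum)
open import Data.Fin using (Fin; _≟_)
open import Data.Fin.Subset using (_∪_) renaming (_∈_ to _∈ₛ_)
open import Data.Fin.Subset.Properties using (x∈⁅x⁆; x∈p∪q⁺)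
open import Data.Product using (Σ; ∃; _×_; _,_; proj₁; proj₂)
open import Data.Sum using (_⊎_; inj₁; inj₂; [_,_])
open import Data.Empty using (⊥-elim)
open import Data.List using (List; []; _∷_; _++_; length; map; foldl; concatMap)
open import Data.List.Properties using (length-++; length-map)
open import Data.List.Relation.Unary.All as All using (All; []; _∷_)
import Data.List.Relation.Unary.All.Properties as All
open import Data.List.Relation.Unary.AllPairs using (AllPairs; []; _∷_)
open import Data.List.Relation.Unary.Any as Any using (here; there)
open import Data.List.Relation.Unary.Linked.Properties using (Linked⇒AllPairs)
open import Data.List.Membership.Propositional using (_∈_; find)
open import Data.List.Membership.Propositional.Properties
  using (∈-map⁺; ∈-map⁻; ∈-concatMap⁺; ∈-concatMap⁻)
open import Data.List.Relation.Binary.Permutation.Propositional.Properties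
  using (∈-resp-↭; ↭-length)
open import Data.List.Relation.Binary.Permutation.Propositional using (_↭_; ↭-sym)
open import Data.List.Relation.Binary.Sublist.Propositional
  using (_⊆_; []; _∷_; _∷ʳ_; minimum)
import Data.List.Relation.Binary.Sublist.Propositional.Properties as Sublist
import Data.List.Sort as Sort
import Relation.Binary.Construct.On as On
open import Relation.Binary.PropositionalEquality
  using (_≡_; refl; cong₂; module ≡-Reasoning)
open import Relation.Nullary using (yes; no)

module _ {n : ℕ} where

  call-endpoint : (K : Knowledge n) (a b x : Fin n) → x ≡ a ⊎ x ≡ b →
                  call K (a , b) x ≡ K a ∪ K b
  call-endpoint K a b x x∈ab with x ≟ a | x ≟ b
  ... | yes _  | _      = refl
  ... | no _   | yes _  = refl
  ... | no x≢a | no x≢b = ⊥-elim ([ x≢a , x≢b ] x∈ab)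

  call-mono : ∀ (K : Knowledge n) c x {y} → y ∈ₛ K x → y ∈ₛ call K c x
  call-mono K (a , b) x y∈Kx with x ≟ a | x ≟ b
  ... | yes refl | _        = x∈p∪q⁺ (inj₁ y∈Kx)
  ... | no _     | yes refl = x∈p∪q⁺ (inj₂ y∈Kx)
  ... | no _     | no _     = y∈Kx

  calls-mono : ∀ (K : Knowledge n) cs x {y} → y ∈ₛ K x → y ∈ₛ foldl call K cs x
  calls-mono K []       x y∈Kx = y∈Kx
  calls-mono K (c ∷ cs) x y∈Kx = calls-mono (call K c) cs x (call-mono K c x y∈Kx)

  call-shares : ∀ (K : Knowledge n) c {a b y} → SameEdge c (a , b) →
                y ∈ₛ K a → y ∈ₛ call K c b
  call-shares K (a , b) (inj₁ refl) y∈Ka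
    rewrite call-endpoint K a b b (inj₂ refl) = x∈p∪q⁺ (inj₁ y∈Ka)
  call-shares K (b , a) (inj₂ refl) y∈Ka
    rewrite call-endpoint K b a b (inj₁ refl) = x∈p∪q⁺ (inj₂ y∈Ka)

  data Relay : Fin n → List (Edge n) → Fin n → Set where
    []  : ∀ {a} → Relay a [] a
    _∷_ : ∀ {a b v c cs} → SameEdge c (a , b) → Relay b cs v → Relay a (c ∷ cs) v

  relay-spreads : ∀ (K : Knowledge n) {a v ps cs y} → Relay a ps v → ps ⊆ cs →
                  y ∈ₛ K a → y ∈ₛ foldl call K cs v
  relay-spreads K []           []             y∈Ka = y∈Ka
  relay-spreads K {a} relay    (c ∷ʳ ps⊆cs)   y∈Ka =
    relay-spreads (call K c) relay ps⊆cs (call-mono K c a y∈Ka)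
  relay-spreads K (ab ∷ relay) (refl ∷ ps⊆cs) y∈Ka =
    relay-spreads (call K _) relay ps⊆cs (call-shares K _ ab y∈Ka)

module _ {A : Set} (key : A → ℕ) where

  private
    ∈-tails : ∀ {y ys zs} → All (λ z → key y < key z) zs → All (_∈ y ∷ ys) zs →
              All (_∈ ys) zs
    ∈-tails []             []                  = []
    ∈-tails (y<z ∷ y<zs)   (here refl ∷ _)     = ⊥-elim (<-irrefl refl y<z)
    ∈-tails (_ ∷ y<zs)     (there z∈ys ∷ zs∈)  = z∈ys ∷ ∈-tails y<zs zs∈

  -- Strictness is what forces the order: no element of ys before x can be a later x′.
  increasing-⊆-sorted : ∀ {xs ys} →
    AllPairs (λ x x′ → key x < key x′) xs → AllPairs (λ y y′ → key y ≤ key y′) ys →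
    All (_∈ ys) xs → xs ⊆ ys
  increasing-⊆-sorted {[]} _ _ _ = minimum _
  increasing-⊆-sorted {x ∷ xs} {y ∷ ys} (x<xs ∷ xs↗) (_ ∷ ys↗) (here refl ∷ xs∈) =
    refl ∷ increasing-⊆-sorted xs↗ ys↗ (∈-tails x<xs xs∈)
  increasing-⊆-sorted {x ∷ xs} {y ∷ ys} (x<xs ∷ xs↗) (y≤ys ∷ ys↗) (there x∈ys ∷ xs∈) =
    y ∷ʳ increasing-⊆-sorted (x<xs ∷ xs↗) ys↗ (x∈ys ∷ ∈-tails y<xs xs∈)
    where
    y<xs : All (λ x′ → key y < key x′) xs
    y<xs = All.map (≤-<-trans (All.lookup y≤ys x∈ys)) x<xs

TimedEdge : ℕ → Set
TimedEdge n = Edge n × ℕ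

module _ {n : ℕ} where

  timedCopies : LEdge n → List (TimedEdge n)
  timedCopies (e , ls) = map (e ,_) ls

  timedEdges : List (LEdge n) → List (TimedEdge n)
  timedEdges = concatMap timedCopies

  length-timedEdges : (les : List (LEdge n)) →
    length (timedEdges les) ≡ sum (map (λ le → length (proj₂ le)) les)
  length-timedEdges [] = refl
  length-timedEdges (le@(e , ls) ∷ les) = begin
    length (timedCopies le ++ timedEdges les)          ≡⟨ length-++ (timedCopies le) ⟩
    length (timedCopies le) + length (timedEdges les)  ≡⟨ cong₂ _+_ (length-map (e ,_) ls)
                                                                      (length-timedEdges les) ⟩
    length ls + sum (map (λ le → length (proj₂ le)) les) ∎
    where open ≡-Reasoning

  ∈-timedEdges⁺ : ∀ {les e ls t} → (e , ls) ∈ les → t ∈ ls → (e , t) ∈ timedEdges les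
  ∈-timedEdges⁺ e∈les t∈ls =
    ∈-concatMap⁺ timedCopies (Any.map (λ { refl → ∈-map⁺ _ t∈ls }) e∈les)

  ∈-timedEdges⁻ : ∀ {les e t} → (e , t) ∈ timedEdges les →
                  ∃ λ ls → (e , ls) ∈ les × t ∈ ls
  ∈-timedEdges⁻ {les} et∈ with find (∈-concatMap⁻ timedCopies {xs = les} et∈)
  ... | (_ , ls) , e∈les , et∈copies with ∈-map⁻ _ et∈copies
  ...   | _ , t∈ls , refl = ls , e∈les , t∈ls

  -- Ordered by time alone; sort-↭ is nevertheless a permutation up to ≡, so no edge is lost.
  module ByTime = Sort (On.decTotalOrder ≤-decTotalOrder (proj₂ {A = Edge n} {B = λ _ → ℕ}))

module _ {n : ℕ} (G : TemporalGraph n) where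

  storedEdge : ∀ {a b t} → HasEdgeAt G a b t → Edge n
  storedEdge {a} {b} (_ , inj₁ _ , _) = a , b
  storedEdge {a} {b} (_ , inj₂ _ , _) = b , a

  hops : ∀ {a s v vs} → TWalk G a s v vs → List (TimedEdge n)
  hops stop = []
  hops (step {t′ = t} ab _ W) = (storedEdge ab , t) ∷ hops W

  hops-relay : ∀ {a s v vs} (W : TWalk G a s v vs) → Relay a (map proj₁ (hops W)) v
  hops-relay stop = []
  hops-relay (step (_ , inj₁ _ , _) _ W) = inj₁ refl ∷ hops-relay W
  hops-relay (step (_ , inj₂ _ , _) _ W) = inj₂ refl ∷ hops-relay W

  hops-later : ∀ {a s v vs} (W : TWalk G a s v vs) → All (λ h → s < proj₂ h) (hops W)
  hops-later stop = []
  hops-later (step _ s<t W) = s<t ∷ All.map (<-trans s<t) (hops-later W)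

  hops-increasing : ∀ {a s v vs} (W : TWalk G a s v vs) →
                    AllPairs (λ h h′ → proj₂ h < proj₂ h′) (hops W)
  hops-increasing stop = []
  hops-increasing (step _ _ W) = hops-later W ∷ hops-increasing W

  hops-timed : ∀ {a s v vs} (W : TWalk G a s v vs) → All (_∈ timedEdges (ledges G)) (hops W)
  hops-timed stop = []
  hops-timed (step (_ , inj₁ e∈ , t∈) _ W) = ∈-timedEdges⁺ e∈ t∈ ∷ hops-timed W
  hops-timed (step (_ , inj₂ e∈ , t∈) _ W) = ∈-timedEdges⁺ e∈ t∈ ∷ hops-timed W

  timedEdge-isEdge : ∀ {e t} → (e , t) ∈ timedEdges (ledges G) → IsEdge G (proj₁ e) (proj₂ e)
  timedEdge-isEdge et∈ with ∈-timedEdges⁻ {les = ledges G} et∈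
  ... | ls , e∈ , _ = ls , inj₁ e∈

  open ByTime

  schedule : List (TimedEdge n)
  schedule = sort (timedEdges (ledges G))

  schedule-↭ : schedule ↭ timedEdges (ledges G)
  schedule-↭ = sort-↭ (timedEdges (ledges G))

  length-schedule : length (map proj₁ schedule) ≡ size G
  length-schedule = begin
    length (map proj₁ schedule)     ≡⟨ length-map proj₁ schedule ⟩
    length schedule                 ≡⟨ ↭-length schedule-↭ ⟩
    length (timedEdges (ledges G))  ≡⟨ length-timedEdges (ledges G) ⟩
    size G                          ∎
    where open ≡-Reasoning

  schedule-edges : All (λ c → IsEdge G (proj₁ c) (proj₂ c)) (map proj₁ schedule)
  schedule-edges = All.map⁺ (All.tabulate λ et∈ →
    timedEdge-isEdge (∈-resp-↭ schedule-↭ et∈))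

  hops⊆schedule : ∀ {a s v vs} (W : TWalk G a s v vs) → hops W ⊆ schedule
  hops⊆schedule W = increasing-⊆-sorted proj₂ (hops-increasing W)
    (Linked⇒AllPairs ≤-trans (sort-↗ (timedEdges (ledges G))))
    (All.map (∈-resp-↭ (↭-sym schedule-↭)) (hops-timed W))

  schedule-informs : TemporallyConnected G → AllKnowAll (runCalls (map proj₁ schedule))
  schedule-informs connected x y with y ≟ x
  ... | yes refl = calls-mono initial (map proj₁ schedule) x (x∈⁅x⁆ x)
  ... | no y≢x with connected y x y≢x
  ...   | _ , W , _ = relay-spreads initial (hops-relay W)
                        (Sublist.map⁺ proj₁ (hops⊆schedule W)) (x∈⁅x⁆ y)

lemma6 : (n : ℕ) (G : TemporalGraph n) → TemporallyConnected G →
    Σ (List (Fin n × Fin n)) (λ cs →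
      (length cs ≡ size G) ×
      All (λ c → IsEdge G (proj₁ c) (proj₂ c)) cs ×
      AllKnowAll (runCalls cs))
lemma6 n G connected =
  map proj₁ (schedule G) , length-schedule G , schedule-edges G , schedule-informs G connected
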